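{- Let $\mathcal L$ be a finite modular complemented lattice and let $(\mathcal L,r)$ be an $\mathcal L$-polymatroid. If $X\in\mathcal L$ is a flat of $(\mathcal L,r)$, then $\mathrm{cyc}(X)$ is a flat of $(\mathcal L,r)$.
   Context: $\mathcal H(X)$ is the set of elements covered by $X$, $\mathcal A(X)$ the set of atoms below $X$, and $\mathrm h$ the height. An $\mathcal L$-polymatroid is a pair $(\mathcal L,r)$ with $r:\mathcal L\to\mathbb R$ such that, for some $t\ge0$, $0\le r(A)\le t\,\mathrm h(A)$, $r$ is increasing, and $r(A)-r(A\wedge B)\ge r(A\vee B)-r(B)$ for all $A,B$. Notions for $(\mathcal L,r)$: - $X$ is a flat if $r(X)<r(X\vee x)$ for all $x\not\le X$. - $X$ is cyclic if for every $H\in\mathcal H(X)$, either $r(X)=r(H)$, or $0<r(X)-r(H)$ and there is $a\in\mathcal A(X)\setminus\mathcal A(H)$ with $r(X)-r(H)<r(a)$. - $\mathrm{cyc}(X)$ is the join of all cyclic $Y\le X$. -}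

module Defs where

open import Level using (0ℓ)
open import Data.Nat as ℕ using (ℕ; zero; suc)
open import Data.Fin using (Fin)
open import Data.Product using (Σ; ∃; _×_; _,_)
open import Data.Sum using (_⊎_)
open import Relation.Nullary using (¬_)
open import Relation.Binary.Core using (Rel)
open import Relation.Binary.PropositionalEquality using (_≡_; _≢_)
open import Relation.Binary.Structures using (IsTotalOrder)
open import Algebra.Core using (Op₁; Op₂)
import Algebra.Structures as AS
import Relation.Binary.Lattice.Structures as LS

-- The real numbers, axiomatised as a complete ordered field
-- (unique up to isomorphism, so quantifying over all such
-- structures is the same as speaking about ℝ).

record RealNumbers : Set₁ where
  infixl 6 _+_ _-_
  infixl 7 _*_
  infix 4 _≤_ _<_
  field
    ℝ     : Set
    _+_   : Op₂ ℝ
    _*_   : Op₂ ℝ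
    -_    : Op₁ ℝ
    0#    : ℝ
    1#    : ℝ
    _≤_   : Rel ℝ 0ℓ
    isCommutativeRing : AS.IsCommutativeRing _≡_ _+_ _*_ -_ 0# 1#
    0≢1   : 0# ≢ 1#
    *-inverse : ∀ x → x ≢ 0# → ∃ λ y → x * y ≡ 1#
    isTotalOrder : IsTotalOrder _≡_ _≤_
    +-monoˡ-≤ : ∀ {x y} z → x ≤ y → x + z ≤ y + z
    *-nonneg  : ∀ {x y} → 0# ≤ x → 0# ≤ y → 0# ≤ x * y
    complete  : (P : ℝ → Set) → ∃ P → (∃ λ b → ∀ x → P x → x ≤ b) →
                ∃ λ s → (∀ x → P x → x ≤ s) × (∀ b → (∀ x → P x → x ≤ b) → s ≤ b)

  _-_ : Op₂ ℝ
  x - y = x + (- y)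

  _<_ : Rel ℝ 0ℓ
  x < y = x ≤ y × x ≢ y

  fromℕ : ℕ → ℝ
  fromℕ zero    = 0#
  fromℕ (suc n) = 1# + fromℕ n

record FinModComplLattice : Set₁ where
  infix 4 _≤_
  infixr 6 _∨_
  infixr 7 _∧_
  field
    Carrier : Set
    _≤_     : Rel Carrier 0ℓ
    _∨_     : Op₂ Carrier
    _∧_     : Op₂ Carrier
    ⊤       : Carrier
    ⊥       : Carrier
    isBoundedLattice : LS.IsBoundedLattice _≡_ _≤_ _∨_ _∧_ ⊤ ⊥
    modular     : ∀ x y z → x ≤ z → x ∨ (y ∧ z) ≡ (x ∨ y) ∧ z
    complemented : ∀ x → ∃ λ y → (x ∧ y ≡ ⊥) × (x ∨ y ≡ ⊤)
    finite : ∃ λ n → Σ (Fin n → Carrier) λ enum → ∀ x → ∃ λ i → enum i ≡ x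

module LatticeNotions (𝓛 : FinModComplLattice) where
  open FinModComplLattice 𝓛

  _<_ : Rel Carrier 0ℓ
  x < y = x ≤ y × x ≢ y

  CoveredBy : Carrier → Carrier → Set
  CoveredBy H X = H < X × (∀ Z → ¬ (H < Z × Z < X))

  Atom : Carrier → Set
  Atom a = CoveredBy ⊥ a

  data Chain : Carrier → Carrier → ℕ → Set where
    [] : ∀ {x} → Chain x x 0
    _∷_ : ∀ {x y z k} → x < y → Chain y z k → Chain x z (suc k)

  IsHeight : Carrier → ℕ → Set
  IsHeight A k = Chain ⊥ A k × (∀ m → Chain ⊥ A m → m ℕ.≤ k)

  IsJoinOf : (Carrier → Set) → Carrier → Set
  IsJoinOf P Z = (∀ Y → P Y → Y ≤ Z) × (∀ W → (∀ Y → P Y → Y ≤ W) → Z ≤ W)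

module PolymatroidNotions (ℝs : RealNumbers) (𝓛 : FinModComplLattice) where
  open RealNumbers ℝs renaming (_≤_ to _≤ᵣ_; _<_ to _<ᵣ_)
  open FinModComplLattice 𝓛
  open LatticeNotions 𝓛

  record IsPolymatroid (r : Carrier → ℝ) : Set where
    field
      t          : ℝ
      t-nonneg   : 0# ≤ᵣ t
      r-nonneg   : ∀ A → 0# ≤ᵣ r A
      r-bounded  : ∀ A k → IsHeight A k → r A ≤ᵣ t * fromℕ k
      increasing : ∀ A B → A ≤ B → r A ≤ᵣ r B
      submodular : ∀ A B → r (A ∨ B) - r B ≤ᵣ r A - r (A ∧ B)

  module _ (r : Carrier → ℝ) where

    Flat : Carrier → Set
    Flat X = ∀ x → ¬ (x ≤ X) → r X <ᵣ r (X ∨ x)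

    Cyclic : Carrier → Set
    Cyclic X = ∀ H → CoveredBy H X →
      (r X ≡ r H) ⊎
      ((0# <ᵣ r X - r H) ×
       (∃ λ a → Atom a × a ≤ X × ¬ (a ≤ H) × (r X - r H <ᵣ r a)))

    IsCyc : Carrier → Carrier → Set
    IsCyc X C = IsJoinOf (λ Y → Y ≤ X × Cyclic Y) C

{-# OPTIONS --safe #-}

-- Fix C = cyc(X). The heart of the proof is that r(Y ∧ C) < r(Y) for every
-- Y ≰ C below X. Were r(Y ∧ C) = r(Y) for a minimal such Y, then Y would be
-- cyclic: for a coatom H of Y either Y ∧ C ≤ H, so r(H) = r(Y), or some atom
-- a ≤ Y ∧ C avoids H; then Y = a ∨ H, and by modularity Y ∧ C = a ∨ (H ∧ C),
-- so submodularity bounds both r(Y) - r(H) and r(Y) - r(H ∧ C) by r(a), the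
-- first strictly since r(H ∧ C) < r(H) by minimality. Cyclic elements below X
-- lie below C, a contradiction. Flatness of C then follows: for x ≤ X apply
-- this to Y = C ∨ x, and for x ≰ X use flatness of X and submodularity.
-- As neither equality of reals nor of lattice elements is decidable, the
-- case distinctions run in the double-negation monad, which suffices since
-- the inequalities to be shown are negations.

module Submission where

open import Level using (0ℓ)
open import Defs
open import Relation.Binary.PropositionalEquality
  using (_≡_; _≢_; refl; sym; trans; cong; subst; subst₂; module ≡-Reasoning)
open import Data.Product using (∃; _×_; _,_; proj₁; proj₂)
open import Data.Sum using (_⊎_; inj₁; inj₂)
open import Data.Empty using (⊥-elim)
open import Data.Nat as ℕ using (ℕ; zero; suc; z≤n)
import Data.Nat.Properties as ℕ
open import Data.Fin using (Fin) renaming (zero to fzero; suc to fsuc)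
open import Data.Fin.Properties using (injective⇒≤; sequence)
open import Function using (_∘_)
open import Relation.Nullary using (¬_; yes; no; contradiction)
open import Relation.Nullary.Negation using (DoubleNegation; ¬¬-Monad)
open import Relation.Nullary.Decidable using (¬¬-excluded-middle)
open import Effect.Monad using (RawMonad)
open import Induction.WellFounded using (WellFounded; Acc; acc)
open import Relation.Binary.Structures using (IsTotalOrder)
open import Relation.Binary.Lattice.Structures using (IsBoundedLattice)
open import Algebra.Bundles using (CommutativeRing)
import Algebra.Properties.AbelianGroup as AbelianGroupProperties

open RawMonad (¬¬-Monad {0ℓ})

¬¬-→ : {A B : Set} → (A → DoubleNegation B) → DoubleNegation (A → B)
¬¬-→ f ¬[A→B] = ¬[A→B] (λ a → ⊥-elim (f a (λ b → ¬[A→B] (λ _ → b))))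

module OrderedFieldProperties (ℝs : RealNumbers) where
  open RealNumbers ℝs
  open ≡-Reasoning

  +-*-commutativeRing : CommutativeRing 0ℓ 0ℓ
  +-*-commutativeRing = record { isCommutativeRing = isCommutativeRing }

  open CommutativeRing +-*-commutativeRing using (+-comm; +-assoc; +-identityʳ; -‿inverseʳ; +-abelianGroup)
  open AbelianGroupProperties +-abelianGroup
    using (//-rightDividesˡ; \\-leftDividesʳ; ⁻¹-anti-homo‿-; x∙y⁻¹≈ε⇒x≈y; ε⁻¹≈ε)

  private
    variable
      x y z : ℝ

  x-0≡x : x - 0# ≡ x
  x-0≡x {x} = trans (cong (x +_) ε⁻¹≈ε) (+-identityʳ x)

  x-z≤y-z⇒x≤y : x - z ≤ y - z → x ≤ y
  x-z≤y-z⇒x≤y {x} {z} {y} p =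
    subst₂ _≤_ (//-rightDividesˡ z x) (//-rightDividesˡ z y) (+-monoˡ-≤ z p)

  x≤y⇒x-y≤0 : x ≤ y → x - y ≤ 0#
  x≤y⇒x-y≤0 {x} {y} p = subst (x - y ≤_) (-‿inverseʳ y) (+-monoˡ-≤ (- y) p)

  x-y≤0⇒x≤y : x - y ≤ 0# → x ≤ y
  x-y≤0⇒x≤y {x} {y} p = x-z≤y-z⇒x≤y (subst (x - y ≤_) (sym (-‿inverseʳ y)) p)

  x≤y⇒0≤y-x : x ≤ y → 0# ≤ y - x
  x≤y⇒0≤y-x {x} {y} p = subst (_≤ y - x) (-‿inverseʳ x) (+-monoˡ-≤ (- x) p)

  0≤y-x⇒x≤y : 0# ≤ y - x → x ≤ y
  0≤y-x⇒x≤y {y} {x} p = x-z≤y-z⇒x≤y (subst (_≤ y - x) (sym (-‿inverseʳ x)) p)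

  x<y⇒0<y-x : x < y → 0# < y - x
  x<y⇒0<y-x (x≤y , x≢y) =
    x≤y⇒0≤y-x x≤y , λ 0≡y-x → x≢y (sym (x∙y⁻¹≈ε⇒x≈y _ _ (sym 0≡y-x)))

  x-y≤x-z⇒z≤y : x - y ≤ x - z → z ≤ y
  x-y≤x-z⇒z≤y {x} {y} {z} p = 0≤y-x⇒x≤y (subst₂ _≤_ cancel shift (+-monoˡ-≤ (y - x) p))
    where
    cancel : (x - y) + (y - x) ≡ 0#
    cancel = trans (cong ((x - y) +_) (sym (⁻¹-anti-homo‿- x y))) (-‿inverseʳ (x - y))
    shift : (x - z) + (y - x) ≡ y - z
    shift = begin
      (x - z) + (y - x)     ≡⟨ +-comm (x - z) (y - x) ⟩
      (y - x) + (x - z)     ≡⟨ +-assoc y (- x) (x - z) ⟩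
      y + (- x + (x - z))   ≡⟨ cong (y +_) (\\-leftDividesʳ x (- z)) ⟩
      y - z                 ∎

module FiniteLatticeProperties (𝓛 : FinModComplLattice) where
  open FinModComplLattice 𝓛
  open LatticeNotions 𝓛
  open IsBoundedLattice isBoundedLattice
    using (x≤x∨y; y≤x∨y; ∨-least; x∧y≤x; x∧y≤y; ∧-greatest; minimum; maximum; antisym)
    renaming (refl to ≤-refl; trans to ≤-trans)

  private
    variable
      a x y z H P Y Z : Carrier
      k m : ℕ

    card : ℕ
    card = proj₁ finite

    enum : Fin card → Carrier
    enum = proj₁ (proj₂ finite)

    index : Carrier → Fin card
    index x = proj₁ (proj₂ (proj₂ finite) x)

    enum-index : ∀ x → enum (index x) ≡ x
    enum-index x = proj₂ (proj₂ (proj₂ finite) x)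

  ¬¬-∀ : {Q : Carrier → Set} → (∀ x → DoubleNegation (Q x)) → DoubleNegation (∀ x → Q x)
  ¬¬-∀ {Q} h = do
    Q∘enum ← sequence rawApplicative {P = Q ∘ enum} (h ∘ enum)
    pure (λ x → subst Q (enum-index x) (Q∘enum (index x)))

  <-≤-asym : x < y → ¬ y ≤ x
  <-≤-asym (x≤y , x≢y) y≤x = x≢y (antisym x≤y y≤x)

  chain⇒≤ : Chain x z k → x ≤ z
  chain⇒≤ []      = ≤-refl
  chain⇒≤ (p ∷ c) = ≤-trans (proj₁ p) (chain⇒≤ c)

  chain-element : Chain x z k → Fin (suc k) → Carrier
  chain-element {x} _ fzero    = x
  chain-element []      (fsuc ())
  chain-element (_ ∷ c) (fsuc i) = chain-element c i

  source≤chain-element : (c : Chain x z k) → ∀ i → x ≤ chain-element c i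
  source≤chain-element c       fzero    = ≤-refl
  source≤chain-element (p ∷ c) (fsuc i) = ≤-trans (proj₁ p) (source≤chain-element c i)

  chain-element-injective : (c : Chain x z k) → ∀ i j → chain-element c i ≡ chain-element c j → i ≡ j
  chain-element-injective c       fzero    fzero    _ = refl
  chain-element-injective (p ∷ c) fzero    (fsuc j) e =
    contradiction (subst (_ ≤_) (sym e) (source≤chain-element c j)) (<-≤-asym p)
  chain-element-injective (p ∷ c) (fsuc i) fzero    e =
    contradiction (subst (_ ≤_) e (source≤chain-element c i)) (<-≤-asym p)
  chain-element-injective (p ∷ c) (fsuc i) (fsuc j) e = cong fsuc (chain-element-injective c i j e)

  chain-length≤card : Chain x z k → k ℕ.≤ card
  chain-length≤card c = ℕ.<⇒≤ (injective⇒≤ index∘element-injective)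
    where
    index∘element-injective : ∀ {i j} → index (chain-element c i) ≡ index (chain-element c j) → i ≡ j
    index∘element-injective {i} {j} e = chain-element-injective c i j
      (trans (sym (enum-index _)) (trans (cong enum e) (enum-index _)))

  chain-snoc : Chain x y m → y < z → Chain x z (suc m)
  chain-snoc []      p = p ∷ []
  chain-snoc (q ∷ c) p = q ∷ chain-snoc c p

  chains-bounded⇒acc : ∀ k → (∀ {x m} → Chain x Y m → m ℕ.≤ k) → Acc _<_ Y
  chains-bounded⇒acc zero    bound = acc λ W<Y → contradiction (bound (W<Y ∷ [])) λ ()
  chains-bounded⇒acc (suc k) bound = acc λ W<Y →
    chains-bounded⇒acc k (λ c → ℕ.≤-pred (bound (chain-snoc c W<Y)))

  <-wellFounded : WellFounded _<_
  <-wellFounded Y = chains-bounded⇒acc card chain-length≤card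

  height-⊥ : IsHeight ⊥ 0
  height-⊥ = [] , λ where
    _ []              → z≤n
    _ (⊥<y ∷ y↝⊥) → contradiction (chain⇒≤ y↝⊥) (<-≤-asym ⊥<y)

  covered-between : CoveredBy H Y → H ≤ Z → Z ≤ Y → DoubleNegation (Z ≡ H ⊎ Z ≡ Y)
  covered-between (_ , nothing-between) H≤Z Z≤Y neither =
    nothing-between _ ((H≤Z , λ H≡Z → neither (inj₁ (sym H≡Z))) , (Z≤Y , neither ∘ inj₂))

  covered-∧-≰ : CoveredBy H Y → ¬ Y ≤ Z → ¬ Y ∧ Z ≤ H → ¬ H ≤ Z
  covered-∧-≰ {H} {Y} {Z} H⋖Y Y≰Z Y∧Z≰H H≤Z =
    covered-between H⋖Y (∧-greatest (proj₁ (proj₁ H⋖Y)) H≤Z) (x∧y≤x Y Z) λ where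
      (inj₁ Y∧Z≡H) → Y∧Z≰H (subst (_≤ H) (sym Y∧Z≡H) ≤-refl)
      (inj₂ Y∧Z≡Y) → Y≰Z (subst (_≤ Z) Y∧Z≡Y (x∧y≤y Y Z))

  atom-meet : Atom a → ¬ a ≤ H → DoubleNegation (a ∧ H ≡ ⊥)
  atom-meet {a} {H} a-atom a≰H = do
    inj₁ a∧H≡⊥ ← covered-between a-atom (minimum (a ∧ H)) (x∧y≤x a H)
      where inj₂ a∧H≡a → pure (contradiction (subst (_≤ H) a∧H≡a (x∧y≤y a H)) a≰H)
    pure a∧H≡⊥

  atom-join-covered : CoveredBy H Y → a ≤ Y → ¬ a ≤ H → DoubleNegation (a ∨ H ≡ Y)
  atom-join-covered {H} {Y} {a} H⋖Y a≤Y a≰H = do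
    inj₂ a∨H≡Y ← covered-between H⋖Y (y≤x∨y a H) (∨-least a≤Y (proj₁ (proj₁ H⋖Y)))
      where inj₁ a∨H≡H → pure (contradiction (subst (a ≤_) a∨H≡H (x≤x∨y a H)) a≰H)
    pure a∨H≡Y

  atom-below : ¬ Z ≡ ⊥ → DoubleNegation (∃ λ a → Atom a × a ≤ Z)
  atom-below = go (<-wellFounded _)
    where
    go : Acc _<_ Z → ¬ Z ≡ ⊥ → DoubleNegation (∃ λ a → Atom a × a ≤ Z)
    go {Z} (acc rs) Z≢⊥ = do
      yes (W , ⊥<W , W<Z) ← ¬¬-excluded-middle {A = ∃ λ W → ⊥ < W × W < Z}
        where no ∄W → pure (Z , ((minimum Z , Z≢⊥ ∘ sym) , λ W p → ∄W (W , p)) , ≤-refl)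
      a , a-atom , a≤W ← go (rs W<Z) (proj₂ ⊥<W ∘ sym)
      pure (a , a-atom , ≤-trans a≤W (proj₁ W<Z))

  -- A complement of P ∧ H inside P is nonzero, and its atoms avoid H.
  atom-outside : ¬ P ≤ H → DoubleNegation (∃ λ a → Atom a × a ≤ P × ¬ a ≤ H)
  atom-outside {P} {H} P≰H = do
    a , a-atom , a≤D ← atom-below D≢⊥
    let a≤P = ≤-trans a≤D (x∧y≤y c P)
    pure (a , a-atom , a≤P , λ a≤H →
      proj₂ (proj₁ a-atom) (antisym (minimum a)
        (subst (a ≤_) P∧H∧c≡⊥ (∧-greatest (∧-greatest a≤P a≤H) (≤-trans a≤D (x∧y≤x c P))))))
    where
    c : Carrier
    c = proj₁ (complemented (P ∧ H))
    P∧H∧c≡⊥ : (P ∧ H) ∧ c ≡ ⊥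
    P∧H∧c≡⊥ = proj₁ (proj₂ (complemented (P ∧ H)))
    D : Carrier
    D = c ∧ P
    P∧H∨D≡P : P ∧ H ∨ D ≡ P
    P∧H∨D≡P = trans (modular (P ∧ H) c P (x∧y≤x P H))
      (trans (cong (_∧ P) (proj₂ (proj₂ (complemented (P ∧ H)))))
        (antisym (x∧y≤y ⊤ P) (∧-greatest (maximum P) ≤-refl)))
    D≢⊥ : ¬ D ≡ ⊥
    D≢⊥ D≡⊥ = P≰H (subst (_≤ H) P∧H∨D≡P
      (∨-least (x∧y≤y P H) (subst (_≤ H) (sym D≡⊥) (minimum H))))

module PolymatroidProperties
  (ℝs : RealNumbers) (𝓛 : FinModComplLattice) (r : FinModComplLattice.Carrier 𝓛 → RealNumbers.ℝ ℝs)
  (polymatroid : PolymatroidNotions.IsPolymatroid ℝs 𝓛 r) where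

  open RealNumbers ℝs renaming (_≤_ to _≤ᵣ_; _<_ to _<ᵣ_)
  open IsTotalOrder isTotalOrder using () renaming (antisym to ≤ᵣ-antisym; trans to ≤ᵣ-trans)
  open OrderedFieldProperties ℝs
  open FinModComplLattice 𝓛
  open LatticeNotions 𝓛
  open FiniteLatticeProperties 𝓛
  open PolymatroidNotions ℝs 𝓛
  open IsPolymatroid polymatroid
  open IsBoundedLattice isBoundedLattice
    using (x≤x∨y; y≤x∨y; ∨-least; x∧y≤x; x∧y≤y; ∧-greatest; antisym)
    renaming (refl to ≤-refl; trans to ≤-trans)

  private
    variable
      a x C H H′ X Y Y′ : Carrier

  CyclicAt : Carrier → Carrier → Set
  CyclicAt Y H =
    (r Y ≡ r H) ⊎
    ((0# <ᵣ r Y - r H) × (∃ λ a → Atom a × a ≤ Y × ¬ a ≤ H × (r Y - r H <ᵣ r a)))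

  r-⊥ : r ⊥ ≡ 0#
  r-⊥ = ≤ᵣ-antisym (subst (r ⊥ ≤ᵣ_) (zeroʳ t) (r-bounded ⊥ 0 height-⊥)) (r-nonneg ⊥)
    where open CommutativeRing +-*-commutativeRing using (zeroʳ)

  r-increment≤ : a ∧ H ≡ ⊥ → r (a ∨ H) - r H ≤ᵣ r a
  r-increment≤ {a} {H} a∧H≡⊥ =
    subst (r (a ∨ H) - r H ≤ᵣ_)
      (trans (cong (λ z → r a - r z) a∧H≡⊥) (trans (cong (λ v → r a - v) r-⊥) x-0≡x))
      (submodular a H)

  r-increment< : H′ ≤ H → a ∨ H ≡ Y → a ∧ H ≡ ⊥ → a ∨ H′ ≡ Y′ → a ∧ H′ ≡ ⊥ →
                 r Y′ ≡ r Y → r H′ ≢ r H → r Y - r H <ᵣ r a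
  r-increment< {H′} {H} {a} H′≤H a∨H≡Y a∧H≡⊥ a∨H′≡Y′ a∧H′≡⊥ rY′≡rY rH′≢rH =
    subst (λ z → r z - r H ≤ᵣ r a) a∨H≡Y (r-increment≤ a∧H≡⊥) , λ rY-rH≡ra →
      rH′≢rH (≤ᵣ-antisym (increasing H′ H H′≤H) (x-y≤x-z⇒z≤y
        (subst₂ (λ u v → u - r H′ ≤ᵣ v) (trans (cong r a∨H′≡Y′) rY′≡rY) (sym rY-rH≡ra)
          (r-increment≤ a∧H′≡⊥))))

  covered-cyclicAt : CoveredBy H Y → ¬ Y ≤ C → r Y ≡ r (Y ∧ C) →
                     (¬ H ≤ C → r (H ∧ C) ≢ r H) → DoubleNegation (CyclicAt Y H)
  covered-cyclicAt {H} {Y} {C} H⋖Y Y≰C rY≡rY∧C H-drops = do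
    no Y∧C≰H ← ¬¬-excluded-middle
      where yes Y∧C≤H → pure (inj₁ (≤ᵣ-antisym
              (subst (_≤ᵣ r H) (sym rY≡rY∧C) (increasing _ _ Y∧C≤H)) (increasing _ _ H≤Y)))
    no rY≢rH ← ¬¬-excluded-middle
      where yes rY≡rH → pure (inj₁ rY≡rH)
    a , a-atom , a≤Y∧C , a≰H ← atom-outside Y∧C≰H
    let a≤C = ≤-trans a≤Y∧C (x∧y≤y Y C)
        a≤Y = ≤-trans a≤Y∧C (x∧y≤x Y C)
    a∨H≡Y ← atom-join-covered H⋖Y a≤Y a≰H
    a∧H≡⊥ ← atom-meet a-atom a≰H
    a∧H∧C≡⊥ ← atom-meet a-atom (a≰H ∘ λ a≤H∧C → ≤-trans a≤H∧C (x∧y≤x H C))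
    let a∨H∧C≡Y∧C = trans (modular a H C a≤C) (cong (_∧ C) a∨H≡Y)
    pure (inj₂ (x<y⇒0<y-x (increasing _ _ H≤Y , rY≢rH ∘ sym) , a , a-atom , a≤Y , a≰H ,
      r-increment< (x∧y≤x H C) a∨H≡Y a∧H≡⊥ a∨H∧C≡Y∧C a∧H∧C≡⊥ (sym rY≡rY∧C)
        (H-drops (covered-∧-≰ H⋖Y Y≰C Y∧C≰H))))
    where
    H≤Y = proj₁ (proj₁ H⋖Y)

  rank-drops : ∀ Y → (∀ Z → Z ≤ Y → Cyclic r Z → Z ≤ C) → ¬ Y ≤ C → r (Y ∧ C) ≢ r Y
  rank-drops {C} Y = go (<-wellFounded Y)
    where
    go : ∀ {Y} → Acc _<_ Y → (∀ Z → Z ≤ Y → Cyclic r Z → Z ≤ C) → ¬ Y ≤ C → r (Y ∧ C) ≢ r Y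
    go {Y} (acc rs) cyclic≤C Y≰C rY∧C≡rY =
      ¬¬-∀ (λ H → ¬¬-→ λ H⋖Y → covered-cyclicAt H⋖Y Y≰C (sym rY∧C≡rY)
        (go (rs (proj₁ H⋖Y)) (λ Z Z≤H → cyclic≤C Z (≤-trans Z≤H (proj₁ (proj₁ H⋖Y))))))
      (Y≰C ∘ cyclic≤C Y ≤-refl)

  flat-rank-jump : Flat r X → C ≤ X → ¬ x ≤ X → r C ≢ r (C ∨ x)
  flat-rank-jump {X} {C} {x} X-flat C≤X x≰X rC≡rC∨x =
    proj₂ (X-flat x x≰X) (≤ᵣ-antisym (proj₁ (X-flat x x≰X)) (x-y≤0⇒x≤y
      (≤ᵣ-trans (subst (λ z → r z - r X ≤ᵣ r (C ∨ x) - r ((C ∨ x) ∧ X)) C∨x∨X≡X∨x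
          (submodular (C ∨ x) X))
        (x≤y⇒x-y≤0 (subst (_≤ᵣ r ((C ∨ x) ∧ X)) rC≡rC∨x
          (increasing _ _ (∧-greatest (x≤x∨y C x) C≤X)))))))
    where
    C∨x∨X≡X∨x : (C ∨ x) ∨ X ≡ X ∨ x
    C∨x∨X≡X∨x = antisym
      (∨-least (∨-least (≤-trans C≤X (x≤x∨y X x)) (y≤x∨y X x)) (x≤x∨y X x))
      (∨-least (y≤x∨y (C ∨ x) X) (≤-trans (y≤x∨y C x) (x≤x∨y (C ∨ x) X)))

lemma4p6 : (ℝs : RealNumbers) (𝓛 : FinModComplLattice) (r : FinModComplLattice.Carrier 𝓛 → RealNumbers.ℝ ℝs) → PolymatroidNotions.IsPolymatroid ℝs 𝓛 r → (X C : FinModComplLattice.Carrier 𝓛) → PolymatroidNotions.Flat ℝs 𝓛 r X → PolymatroidNotions.IsCyc ℝs 𝓛 r X C → PolymatroidNotions.Flat ℝs 𝓛 r C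
lemma4p6 ℝs 𝓛 r polymatroid X C X-flat (cyclic≤C , C-least) x x≰C =
  increasing C (C ∨ x) (x≤x∨y C x) , λ rC≡rC∨x → ¬¬-excluded-middle λ where
    (yes x≤X) → rank-drops (C ∨ x)
      (λ Z Z≤C∨x Z-cyclic → cyclic≤C Z (≤-trans Z≤C∨x (∨-least C≤X x≤X) , Z-cyclic))
      (x≰C ∘ ≤-trans (y≤x∨y C x))
      (trans (cong r C∨x∧C≡C) rC≡rC∨x)
    (no x≰X) → flat-rank-jump X-flat C≤X x≰X rC≡rC∨x
  where
  open FinModComplLattice 𝓛
  open PolymatroidProperties ℝs 𝓛 r polymatroid
  open PolymatroidNotions.IsPolymatroid polymatroid using (increasing)
  open IsBoundedLattice isBoundedLattice
    using (x≤x∨y; y≤x∨y; ∨-least; x∧y≤y; ∧-greatest; antisym)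
    renaming (refl to ≤-refl; trans to ≤-trans)
  C≤X : C ≤ X
  C≤X = C-least X (λ _ → proj₁)
  C∨x∧C≡C : (C ∨ x) ∧ C ≡ C
  C∨x∧C≡C = antisym (x∧y≤y (C ∨ x) C) (∧-greatest (x≤x∨y C x) ≤-refl)
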